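{- The nd-matrix $\mathbb{M}_{\mathbf{mCi}}$ is not sufficiently expressive.
   Context: Let $\Sigma$ be the signature with unary connectives $\neg,\circ$ and binary connectives $\land,\lor,\to$, over a denumerable set $P$ of propositional variables. A $\Sigma$-nd-algebra $\mathbf{A}$ consists of a non-empty carrier $A$ and, for each $k$-ary connective $©$, a multifunction $©^{\mathbf{A}}:A^k\to\mathcal{P}(A)$. A valuation on $\mathbf{A}$ is a map $v$ from formulas to $A$ with $v(©(\varphi_1,\ldots,\varphi_k))\in ©^{\mathbf{A}}(v(\varphi_1),\ldots,v(\varphi_k))$ for all connectives and formulas. For a formula $\varphi$ whose only variable is $p$ and $x\in A$, let $\varphi^{\mathbf{A}}(x)=\{v(\varphi): v \text{ a valuation on }\mathbf{A} \text{ with } v(p)=x\}$. An nd-matrix $\langle\mathbf{A},D\rangle$ with $D\subseteq A$ is sufficiently expressive if for every pair of distinct $x,y\in A$ there is a formula $\varphi$ with $p$ as its only variable such that either $\varphi^{\mathbf{A}}(x)\subseteq D$ and $\varphi^{\mathbf{A}}(y)\subseteq A\setminus D$, or $\varphi^{\mathbf{A}}(x)\subseteq A\setminus D$ and $\varphi^{\mathbf{A}}(y)\subseteq D$. The nd-matrix $\mathbb{M}_{\mathbf{mCi}}=\langle\mathbf{A}_{\mathbf{mCi}},D\rangle$ has carrier $\{f,F,I,T,t\}$ and $D=\{I,T,t\}$, with: $x_1\land x_2=\{f\}$ if $x_1\notin D$ or $x_2\notin D$, and $\{I,t\}$ otherwise; $x_1\lor x_2=\{I,t\}$ if $x_1\in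 D$ or $x_2\in D$, and $\{f\}$ otherwise; $x_1\to x_2=\{I,t\}$ if $x_1\notin D$ or $x_2\in D$, and $\{f\}$ otherwise; $\neg f=\{I,t\}$, $\neg F=\{T\}$, $\neg I=\{I,t\}$, $\neg T=\{F\}$, $\neg t=\{f\}$; $\circ f=\circ F=\circ T=\circ t=\{T\}$ and $\circ I=\{F\}$. -}

module Defs where

open import Level using (Level; suc; _⊔_)
open import Data.Nat using (ℕ)
open import Data.Empty using (⊥)
open import Data.Unit using (⊤)
open import Data.Product using (Σ; _×_; ∃)
open import Data.Sum using (_⊎_)
open import Relation.Nullary using (¬_)
open import Relation.Binary.PropositionalEquality using (_≡_)

data Fm : Set where
  var  : ℕ → Fm
  neg  : Fm → Fm
  circ : Fm → Fm
  and  : Fm → Fm → Fm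
  or   : Fm → Fm → Fm
  imp  : Fm → Fm → Fm

data OnlyVar (p : ℕ) : Fm → Set where
  ov-var  : OnlyVar p (var p)
  ov-neg  : ∀ {φ} → OnlyVar p φ → OnlyVar p (neg φ)
  ov-circ : ∀ {φ} → OnlyVar p φ → OnlyVar p (circ φ)
  ov-and  : ∀ {φ ψ} → OnlyVar p φ → OnlyVar p ψ → OnlyVar p (and φ ψ)
  ov-or   : ∀ {φ ψ} → OnlyVar p φ → OnlyVar p ψ → OnlyVar p (or φ ψ)
  ov-imp  : ∀ {φ ψ} → OnlyVar p φ → OnlyVar p ψ → OnlyVar p (imp φ ψ)

-- A Σ-nd-algebra: carrier and multifunctions, where a multifunction
-- A^k → 𝒫(A) is given by its membership predicate (the last argument
-- is the candidate output).
record NdAlgebra : Set₁ where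
  field
    Carrier : Set
    inhabited : Carrier
    negᴬ  : Carrier → Carrier → Set
    circᴬ : Carrier → Carrier → Set
    andᴬ  : Carrier → Carrier → Carrier → Set
    orᴬ   : Carrier → Carrier → Carrier → Set
    impᴬ  : Carrier → Carrier → Carrier → Set

module _ (𝐀 : NdAlgebra) where
  open NdAlgebra 𝐀

  IsValuation : (Fm → Carrier) → Set
  IsValuation v =
      (∀ φ → negᴬ (v φ) (v (neg φ)))
    × (∀ φ → circᴬ (v φ) (v (circ φ)))
    × (∀ φ ψ → andᴬ (v φ) (v ψ) (v (and φ ψ)))
    × (∀ φ ψ → orᴬ (v φ) (v ψ) (v (or φ ψ)))
    × (∀ φ ψ → impᴬ (v φ) (v ψ) (v (imp φ ψ)))

  -- φ^𝐀(x) ⊆ S, where φ^𝐀(x) = { v(φ) | v valuation, v(p) = x }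
  ImageSub : ℕ → Fm → Carrier → (Carrier → Set) → Set
  ImageSub p φ x S = ∀ v → IsValuation v → v (var p) ≡ x → S (v φ)

record NdMatrix : Set₁ where
  field
    alg : NdAlgebra
    D   : NdAlgebra.Carrier alg → Set

SufficientlyExpressive : NdMatrix → Set
SufficientlyExpressive M =
  ∀ (x y : Carrier) → ¬ (x ≡ y) →
    Σ ℕ λ p → Σ Fm λ φ → OnlyVar p φ ×
      ( (ImageSub alg p φ x D × ImageSub alg p φ y (λ z → ¬ D z))
      ⊎ (ImageSub alg p φ x (λ z → ¬ D z) × ImageSub alg p φ y D) )
  where open NdMatrix M
        open NdAlgebra alg

data V : Set where
  f F I T t : V

Des : V → Set
Des f = ⊥
Des F = ⊥
Des I = ⊤
Des T = ⊤
Des t = ⊤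

InIt : V → Set
InIt I = ⊤
InIt t = ⊤
InIt _ = ⊥

Isf : V → Set
Isf z = z ≡ f

andM : V → V → V → Set
andM x₁ x₂ z = ((¬ Des x₁ ⊎ ¬ Des x₂) × Isf z) ⊎ ((Des x₁ × Des x₂) × InIt z)

orM : V → V → V → Set
orM x₁ x₂ z = ((Des x₁ ⊎ Des x₂) × InIt z) ⊎ ((¬ Des x₁ × ¬ Des x₂) × Isf z)

impM : V → V → V → Set
impM x₁ x₂ z = ((¬ Des x₁ ⊎ Des x₂) × InIt z) ⊎ ((Des x₁ × ¬ Des x₂) × Isf z)

negM : V → V → Set
negM f z = InIt z
negM F z = z ≡ T
negM I z = InIt z
negM T z = z ≡ F
negM t z = z ≡ f

circM : V → V → Set
circM f z = z ≡ T
circM F z = z ≡ T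
circM I z = z ≡ F
circM T z = z ≡ T
circM t z = z ≡ T

A-mCi : NdAlgebra
A-mCi = record
  { Carrier = V ; inhabited = f
  ; negᴬ = negM ; circᴬ = circM ; andᴬ = andM ; orᴬ = orM ; impᴬ = impM }

M-mCi : NdMatrix
M-mCi = record { alg = A-mCi ; D = Des }

-- A valuation may send every variable to the same value and resolve each
-- non-deterministic choice the same way for the two inputs T and t.  Started
-- at T and at t, such valuations stay "twins" on every formula: equal, or the
-- pair (T, t), or the pair (F, f).  Twins are equally designated, so no
-- one-variable formula can separate T from t.
module Submission where

open import Data.Bool using (Bool; true; false; not; _∧_; _∨_)
open import Data.Nat using (ℕ)
open import Data.Product using (_×_; _,_)
open import Data.Sum using (_⊎_; inj₁; inj₂)
open import Data.Unit using (tt)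
open import Function using (_∘_)
open import Function.Bundles using (_⇔_; Equivalence)
open import Function.Properties.Equivalence using () renaming (refl to ⇔-refl)
open import Relation.Binary.PropositionalEquality using (_≡_; _≢_; refl; cong₂)
open import Relation.Nullary using (¬_; Dec; yes; no; does)

open import Defs

module _ (M : NdMatrix) where
  open NdMatrix M
  open NdAlgebra alg

  Separates : ℕ → Fm → Carrier → Carrier → Set
  Separates p φ x y =
      (ImageSub alg p φ x D × ImageSub alg p φ y (¬_ ∘ D))
    ⊎ (ImageSub alg p φ x (¬_ ∘ D) × ImageSub alg p φ y D)

  module _ {x y : Carrier} {vx vy : Fm → Carrier}
           (vx-valuation : IsValuation alg vx) (vy-valuation : IsValuation alg vy)
           (vx-var : ∀ p → vx (var p) ≡ x) (vy-var : ∀ p → vy (var p) ≡ y)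
           (D-agree : ∀ φ → D (vx φ) ⇔ D (vy φ)) where

    ¬separates : ∀ p φ → ¬ Separates p φ x y
    ¬separates p φ (inj₁ (x∈D , y∉D)) =
      y∉D vy vy-valuation (vy-var p) (Equivalence.to (D-agree φ) (x∈D vx vx-valuation (vx-var p)))
    ¬separates p φ (inj₂ (x∉D , y∈D)) =
      x∉D vx vx-valuation (vx-var p) (Equivalence.from (D-agree φ) (y∈D vy vy-valuation (vy-var p)))

    ¬sufficientlyExpressive : x ≢ y → ¬ SufficientlyExpressive M
    ¬sufficientlyExpressive x≢y expressive with expressive x y x≢y
    ... | p , φ , _ , separation = ¬separates p φ separation

Des? : ∀ a → Dec (Des a)
Des? f = no λ ()
Des? F = no λ ()
Des? I = yes tt
Des? T = yes tt
Des? t = yes tt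

negᶜ : V → V
negᶜ f = t
negᶜ F = T
negᶜ I = t
negᶜ T = F
negᶜ t = f

circᶜ : V → V
circᶜ I = F
circᶜ _ = T

-- The binary connectives of 𝕄_mCi only inspect designation; we always pick
-- t for a classically true result and f for a false one.
classical : Bool → V
classical true  = t
classical false = f

binaryᶜ : (Bool → Bool → Bool) → V → V → V
binaryᶜ _⊙_ a b = classical (does (Des? a) ⊙ does (Des? b))

_→ᵇ_ : Bool → Bool → Bool
u →ᵇ v = not u ∨ v

andᶜ orᶜ impᶜ : V → V → V
andᶜ = binaryᶜ _∧_
orᶜ  = binaryᶜ _∨_
impᶜ = binaryᶜ _→ᵇ_

negM-negᶜ : ∀ a → negM a (negᶜ a)
negM-negᶜ f = tt
negM-negᶜ F = refl
negM-negᶜ I = tt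
negM-negᶜ T = refl
negM-negᶜ t = refl

circM-circᶜ : ∀ a → circM a (circᶜ a)
circM-circᶜ f = refl
circM-circᶜ F = refl
circM-circᶜ I = refl
circM-circᶜ T = refl
circM-circᶜ t = refl

andM-andᶜ : ∀ a b → andM a b (andᶜ a b)
andM-andᶜ a b with Des? a | Des? b
... | yes a∈D | yes b∈D = inj₂ ((a∈D , b∈D) , tt)
... | yes _   | no b∉D  = inj₁ (inj₂ b∉D , refl)
... | no a∉D  | _       = inj₁ (inj₁ a∉D , refl)

orM-orᶜ : ∀ a b → orM a b (orᶜ a b)
orM-orᶜ a b with Des? a | Des? b
... | yes a∈D | _       = inj₁ (inj₁ a∈D , tt)
... | no _    | yes b∈D = inj₁ (inj₂ b∈D , tt)
... | no a∉D  | no b∉D  = inj₂ ((a∉D , b∉D) , refl)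

impM-impᶜ : ∀ a b → impM a b (impᶜ a b)
impM-impᶜ a b with Des? a | Des? b
... | no a∉D  | _       = inj₁ (inj₁ a∉D , tt)
... | yes _   | yes b∈D = inj₁ (inj₂ b∈D , tt)
... | yes a∈D | no b∉D  = inj₂ ((a∈D , b∉D) , refl)

eval : V → Fm → V
eval x (var _)   = x
eval x (neg φ)   = negᶜ (eval x φ)
eval x (circ φ)  = circᶜ (eval x φ)
eval x (and φ ψ) = andᶜ (eval x φ) (eval x ψ)
eval x (or φ ψ)  = orᶜ (eval x φ) (eval x ψ)
eval x (imp φ ψ) = impᶜ (eval x φ) (eval x ψ)

eval-isValuation : ∀ x → IsValuation A-mCi (eval x)
eval-isValuation x =
    (λ φ → negM-negᶜ (eval x φ))
  , (λ φ → circM-circᶜ (eval x φ))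
  , (λ φ ψ → andM-andᶜ (eval x φ) (eval x ψ))
  , (λ φ ψ → orM-orᶜ (eval x φ) (eval x ψ))
  , (λ φ ψ → impM-impᶜ (eval x φ) (eval x ψ))

infix 4 _∼_

data _∼_ : V → V → Set where
  ∼-refl : ∀ {a} → a ∼ a
  T∼t    : T ∼ t
  F∼f    : F ∼ f

∼-Des : ∀ {a b} → a ∼ b → Des a ⇔ Des b
∼-Des ∼-refl = ⇔-refl
∼-Des T∼t    = ⇔-refl
∼-Des F∼f    = ⇔-refl

∼-does : ∀ {a b} → a ∼ b → does (Des? a) ≡ does (Des? b)
∼-does ∼-refl = refl
∼-does T∼t    = refl
∼-does F∼f    = refl

negᶜ-∼ : ∀ {a b} → a ∼ b → negᶜ a ∼ negᶜ b
negᶜ-∼ ∼-refl = ∼-refl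
negᶜ-∼ T∼t    = F∼f
negᶜ-∼ F∼f    = T∼t

circᶜ-≡ : ∀ {a b} → a ∼ b → circᶜ a ≡ circᶜ b
circᶜ-≡ ∼-refl = refl
circᶜ-≡ T∼t    = refl
circᶜ-≡ F∼f    = refl

binaryᶜ-≡ : ∀ _⊙_ {a a′ b b′} → a ∼ a′ → b ∼ b′ → binaryᶜ _⊙_ a b ≡ binaryᶜ _⊙_ a′ b′
binaryᶜ-≡ _⊙_ a∼a′ b∼b′ = cong₂ (λ u v → classical (u ⊙ v)) (∼-does a∼a′) (∼-does b∼b′)

≡⇒∼ : ∀ {a b} → a ≡ b → a ∼ b
≡⇒∼ refl = ∼-refl

eval-T∼eval-t : ∀ φ → eval T φ ∼ eval t φ
eval-T∼eval-t (var _)   = T∼t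
eval-T∼eval-t (neg φ)   = negᶜ-∼ (eval-T∼eval-t φ)
eval-T∼eval-t (circ φ)  = ≡⇒∼ (circᶜ-≡ (eval-T∼eval-t φ))
eval-T∼eval-t (and φ ψ) = ≡⇒∼ (binaryᶜ-≡ _∧_ (eval-T∼eval-t φ) (eval-T∼eval-t ψ))
eval-T∼eval-t (or φ ψ)  = ≡⇒∼ (binaryᶜ-≡ _∨_ (eval-T∼eval-t φ) (eval-T∼eval-t ψ))
eval-T∼eval-t (imp φ ψ) = ≡⇒∼ (binaryᶜ-≡ _→ᵇ_ (eval-T∼eval-t φ) (eval-T∼eval-t ψ))

corollary1 : ¬ SufficientlyExpressive M-mCi
corollary1 =
  ¬sufficientlyExpressive M-mCi (eval-isValuation T) (eval-isValuation t)
    (λ _ → refl) (λ _ → refl) (∼-Des ∘ eval-T∼eval-t) (λ ())
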